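{- Let $G=(A\cup B,E)$ be a finite simple bipartite graph with no isolated vertices, $|A|=n_1$, $|B|=n_2$, $n=n_1+n_2$. Let $\Delta_A=\max_{a\in A}d(a)$, $\Delta_B=\max_{b\in B}d(b)$ and $\Delta'=\min\{\Delta_A,\Delta_B\}$. Let $G'$ be the random graph output by the procedure RANDUNIT$(G)$ described below. Then for every $a\in A$ and $b\in B$ with $(a,b)\notin E(G)$, $$\Pr[(a,b)\in E(G')]\le \frac{\Delta'}{\Delta'+1}.$$
   Context: For a bipartite graph with parts $X,Y$ (every vertex of $Y$ having a neighbour) and a bijection $\pi:X\to\{1,\dots,|X|\}$, define $U(\pi,X,Y,G)$ as the graph on $X\cup Y$ where, with $n=|X|+|Y|$, $f(v)=\pi(v)$ for $v\in X$, $f(v)=n+\min_{x\in N(v)}\pi(x)$ for $v\in Y$, and distinct $u,v$ are adjacent iff $|f(u)-f(v)|\le n$. Procedure RANDUNIT$(G)$: if $\Delta_B\le\Delta_A$, choose a permutation $\pi$ of $A$ uniformly at random and output $U(\pi,A,B,G)$; otherwise choose a permutation $\pi$ of $B$ uniformly at random and output $U(\pi,B,A,G)$. $d(v)$ is the degree of $v$ and $N(v)$ its neighbourhood. -}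

module Defs where

open import Data.Bool using (Bool; true; false; _∧_; _∨_; not; if_then_else_)
open import Data.Nat using (ℕ; zero; suc; _+_; _*_; _≤_; _≤?_; _⊔_; _⊓_; ∣_-_∣)
open import Data.Fin using (Fin; toℕ)
open import Data.Fin.Properties using () renaming (_≟_ to _≟F_)
open import Data.List using (List; []; _∷_; map; concatMap; filterᵇ; length; foldr)
open import Data.Vec using (Vec; lookup) renaming ([] to []ᵥ; _∷_ to _∷ᵥ_)
open import Data.Fin using (_≟_)
open import Data.List using () renaming (allFin to allFinL)
open import Data.Sum using (_⊎_; inj₁; inj₂)
open import Data.Sum.Properties using (≡-dec)
open import Relation.Nullary.Decidable using (⌊_⌋; does)

BipGraph : ℕ → ℕ → Set
BipGraph n₁ n₂ = Fin n₁ → Fin n₂ → Bool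

transposeG : ∀ {n₁ n₂} → BipGraph n₁ n₂ → BipGraph n₂ n₁
transposeG E y x = E x y

allᵇ : ∀ {a} {A : Set a} → (A → Bool) → List A → Bool
allᵇ p = foldr (λ x r → p x ∧ r) true

countFin : ∀ {m} → (Fin m → Bool) → ℕ
countFin {m} p = length (filterᵇ (λ i → (p i)) (allFinL m))

-- maximum of a function over Fin m (0 if m = 0)
maxFin : ∀ {m} → (Fin m → ℕ) → ℕ
maxFin {m} f = foldr (λ i r → f i ⊔ r) 0 (allFinL m)

degA : ∀ {n₁ n₂} → BipGraph n₁ n₂ → Fin n₁ → ℕ
degA E a = countFin (λ b → E a b)

degB : ∀ {n₁ n₂} → BipGraph n₁ n₂ → Fin n₂ → ℕ
degB E b = countFin (λ a → E a b)

ΔA : ∀ {n₁ n₂} → BipGraph n₁ n₂ → ℕ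
ΔA E = maxFin (degA E)

ΔB : ∀ {n₁ n₂} → BipGraph n₁ n₂ → ℕ
ΔB E = maxFin (degB E)

Δ′ : ∀ {n₁ n₂} → BipGraph n₁ n₂ → ℕ
Δ′ E = ΔA E ⊓ ΔB E

-- An ordering π : X → {1,…,|X|} is represented by a vector v : Vec (Fin k) k
-- with π(x) = toℕ (lookup v x) + 1; it is a bijection iff v is injective.
isPerm : ∀ {k} → Vec (Fin k) k → Bool
isPerm {k} v =
  allᵇ (λ i → allᵇ (λ j → does (i ≟ j) ∨ not (does (lookup v i ≟ lookup v j)))
                 (allFinL k))
      (allFinL k)

allVecs : ∀ m l → List (Vec (Fin m) l)
allVecs m zero = []ᵥ ∷ []
allVecs m (suc l) = concatMap (λ i → map (i ∷ᵥ_) (allVecs m l)) (allFinL m)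

allPerms : ∀ k → List (Vec (Fin k) k)
allPerms k = filterᵇ (λ v → (isPerm v)) (allVecs k k)

πval : ∀ {k} → Vec (Fin k) k → Fin k → ℕ
πval v x = suc (toℕ (lookup v x))

-- min_{x ∈ N(y)} π(x).  The fold starts at |X| = k, which is ≥ every π-value,
-- so when y has a neighbour (standing assumption) this is exactly the minimum.
minNbr : ∀ {k m} → BipGraph k m → Vec (Fin k) k → Fin m → ℕ
minNbr {k} E v y =
  foldr (λ x r → if E x y then πval v x ⊓ r else r) k (allFinL k)

-- The graph U(π, X, Y, G) on vertex set X ⊎ Y (X = Fin k, Y = Fin m).
fU : ∀ {k m} → BipGraph k m → Vec (Fin k) k → Fin k ⊎ Fin m → ℕ
fU E v (inj₁ x) = πval v x
fU {k} {m} E v (inj₂ y) = (k + m) + minNbr E v y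

adjU : ∀ {k m} → BipGraph k m → Vec (Fin k) k → Fin k ⊎ Fin m → Fin k ⊎ Fin m → Bool
adjU {k} {m} E v u w =
  not (does (≡-dec _≟_ _≟_ u w)) ∧ does (∣ fU E v u - fU E v w ∣ ≤? (k + m))

-- RANDUNIT(G): the probability that (a,b) is an edge of the output, as a
-- fraction  favourable / total  over the uniformly random permutation.
randUnitFavourable : ∀ {n₁ n₂} → BipGraph n₁ n₂ → Fin n₁ → Fin n₂ → ℕ
randUnitFavourable {n₁} {n₂} E a b with does (ΔB E ≤? ΔA E)
... | true  = length (filterᵇ (λ v → (adjU E v (inj₁ a) (inj₂ b)))
                             (allPerms n₁))
... | false = length (filterᵇ (λ v → (adjU (transposeG E) v (inj₂ a) (inj₁ b)))
                             (allPerms n₂))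

randUnitTotal : ∀ {n₁ n₂} → BipGraph n₁ n₂ → ℕ
randUnitTotal {n₁} {n₂} E with does (ΔB E ≤? ΔA E)
... | true  = length (allPerms n₁)
... | false = length (allPerms n₂)

module Submission where

-- Fix the part X whose ordering π is random (X = A if Δ_B ≤ Δ_A, else X = B), a
-- non-edge x₀ y with x₀ ∈ X, y ∈ Y, and write m(π) = min_{x ∈ N(y)} π(x).  Since
-- f(x₀) = π(x₀) ≤ |X| < f(y) = n + m(π), x₀ y is an edge of U(π) only if
-- m(π) ≤ π(x₀); call such π favourable.  If π is favourable and s ∈ N(y) attains
-- m(π), exchanging the values of π at x₀ and s yields π′ with π′(x₀) = m(π) <
-- m(π′), so π′ is unfavourable.  Exchanging at s is a bijection of the orderings,
-- so double counting over s ∈ N(y) gives  #fav ≤ d(y) · #unfav ≤ Δ′ · #unfav,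
-- which is  #fav · (Δ′ + 1) ≤ Δ′ · #all.

open import Defs
open import Algebra.Properties.CommutativeSemigroup using (interchange)
open import Data.Bool using (Bool; true; false; _∧_; _∨_; not; if_then_else_; T)
open import Data.Empty using (⊥-elim)
open import Data.Fin using (Fin; toℕ; _≟_) renaming (zero to fzero; suc to fsuc)
open import Data.Fin.Permutation.Components using (transpose; transpose-inverse)
open import Data.Fin.Properties using (toℕ-injective; toℕ<n)
open import Data.List using (List; []; _∷_; _++_; map; concatMap; filterᵇ; length; foldr; tabulate; allFin)
open import Data.List.Membership.Propositional using (_∈_)
open import Data.List.Membership.Propositional.Properties using (∈-allFin; ∈-filter⁺)
open import Data.List.Relation.Unary.Any using (here; there)
open import Data.Nat using (ℕ; zero; suc; _+_; _*_; _∸_; _≤_; _<_; _≤?_; _≤ᵇ_; _⊔_; _⊓_; z≤n)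
open import Data.Nat.Properties
  using (+-assoc; +-comm; *-comm; *-identityˡ; *-identityʳ; *-zeroʳ; *-distribˡ-+;
         +-mono-≤; +-monoʳ-≤; *-monoˡ-≤; +-cancelˡ-≤; ≤-trans; ≤-antisym;
         <-≤-trans; ≤∧≢⇒<; <⇒≱; ≰⇒≥; m≤m+n; m≤n+m; m≤n+m∸n; m≤n⇒∣m-n∣≡n∸m; ∣-∣-comm;
         m⊓n≤m; m⊓n≤n; ⊓-glb; m≤n⇒m⊓n≡m; m≥n⇒m⊓n≡n; m≤m⊔n; m≤n⊔m; ≤-total; ≤ᵇ⇒≤; ≤⇒≤ᵇ;
         suc-injective; +-commutativeSemigroup; module ≤-Reasoning)
open import Data.Product using (∃; _,_; _×_)
open import Data.Sum using (_⊎_; inj₁; inj₂)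
open import Data.Unit using (tt)
open import Data.Vec using (Vec; lookup) renaming ([] to []ᵥ; _∷_ to _∷ᵥ_; tabulate to tabulateᵥ)
open import Data.Vec.Properties using (lookup∘tabulate; tabulate∘lookup; tabulate-cong) renaming (≡-dec to ≡-decᵥ)
open import Function.Definitions using (Injective)
open import Relation.Binary.Definitions using (DecidableEquality)
open import Relation.Binary.PropositionalEquality
  using (_≡_; _≢_; refl; sym; trans; cong; cong₂; subst; subst₂; module ≡-Reasoning)
open import Relation.Nullary using (yes; no; does)
open import Relation.Nullary.Decidable using (dec-true; dec-false; T?)

variable
  A I : Set

∑ : List A → (A → ℕ) → ℕ
∑ []       f = 0
∑ (x ∷ xs) f = f x + ∑ xs f

𝟙 : Bool → ℕ
𝟙 true  = 1
𝟙 false = 0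

count : (A → Bool) → List A → ℕ
count p xs = ∑ xs (λ x → 𝟙 (p x))

∑-cong : (xs : List A) {f g : A → ℕ} → (∀ x → f x ≡ g x) → ∑ xs f ≡ ∑ xs g
∑-cong []       f≡g = refl
∑-cong (x ∷ xs) f≡g = cong₂ _+_ (f≡g x) (∑-cong xs f≡g)

∑-mono : (xs : List A) {f g : A → ℕ} → (∀ x → f x ≤ g x) → ∑ xs f ≤ ∑ xs g
∑-mono []       f≤g = z≤n
∑-mono (x ∷ xs) f≤g = +-mono-≤ (f≤g x) (∑-mono xs f≤g)

∑-zero : (xs : List A) → ∑ xs (λ _ → 0) ≡ 0
∑-zero []       = refl
∑-zero (x ∷ xs) = ∑-zero xs

∑-const : (xs : List A) (c : ℕ) → ∑ xs (λ _ → c) ≡ length xs * c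
∑-const []       c = refl
∑-const (x ∷ xs) c = cong (c +_) (∑-const xs c)

∑-+ : (xs : List A) (f g : A → ℕ) → ∑ xs (λ x → f x + g x) ≡ ∑ xs f + ∑ xs g
∑-+ []       f g = refl
∑-+ (x ∷ xs) f g =
  trans (cong (f x + g x +_) (∑-+ xs f g))
        (interchange +-commutativeSemigroup (f x) (g x) (∑ xs f) (∑ xs g))

∑-*ˡ : (xs : List A) (c : ℕ) (f : A → ℕ) → ∑ xs (λ x → c * f x) ≡ c * ∑ xs f
∑-*ˡ []       c f = sym (*-zeroʳ c)
∑-*ˡ (x ∷ xs) c f = trans (cong (c * f x +_) (∑-*ˡ xs c f)) (sym (*-distribˡ-+ c (f x) (∑ xs f)))

∑-*ʳ : (xs : List A) (c : ℕ) (f : A → ℕ) → ∑ xs (λ x → f x * c) ≡ ∑ xs f * c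
∑-*ʳ xs c f = trans (∑-cong xs (λ x → *-comm (f x) c)) (trans (∑-*ˡ xs c f) (*-comm c (∑ xs f)))

∑-swap : (xs : List A) (ys : List I) (h : A → I → ℕ) →
         ∑ xs (λ x → ∑ ys (λ y → h x y)) ≡ ∑ ys (λ y → ∑ xs (λ x → h x y))
∑-swap []       ys h = sym (∑-zero ys)
∑-swap (x ∷ xs) ys h =
  trans (cong (∑ ys (h x) +_) (∑-swap xs ys h)) (sym (∑-+ ys (h x) (λ y → ∑ xs (λ x′ → h x′ y))))

∑-++ : (xs ys : List A) (f : A → ℕ) → ∑ (xs ++ ys) f ≡ ∑ xs f + ∑ ys f
∑-++ []       ys f = refl
∑-++ (x ∷ xs) ys f = trans (cong (f x +_) (∑-++ xs ys f)) (sym (+-assoc (f x) (∑ xs f) (∑ ys f)))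

∑-map : (g : A → I) (xs : List A) (f : I → ℕ) → ∑ (map g xs) f ≡ ∑ xs (λ x → f (g x))
∑-map g []       f = refl
∑-map g (x ∷ xs) f = cong (f (g x) +_) (∑-map g xs f)

∑-concatMap : (g : A → List I) (xs : List A) (f : I → ℕ) →
              ∑ (concatMap g xs) f ≡ ∑ xs (λ x → ∑ (g x) f)
∑-concatMap g []       f = refl
∑-concatMap g (x ∷ xs) f =
  trans (∑-++ (g x) (concatMap g xs) f) (cong (∑ (g x) f +_) (∑-concatMap g xs f))

∑-tabulate : ∀ n (g : Fin n → A) (f : A → ℕ) → ∑ (tabulate g) f ≡ ∑ (allFin n) (λ i → f (g i))
∑-tabulate zero    g f = refl
∑-tabulate (suc n) g f =
  cong (f (g fzero) +_) (trans (∑-tabulate n (λ i → g (fsuc i)) f) (sym (∑-tabulate n fsuc (λ i → f (g i)))))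

∑-∈ : {xs : List A} {x : A} (f : A → ℕ) → x ∈ xs → f x ≤ ∑ xs f
∑-∈ {xs = y ∷ ys} f (here refl) = m≤m+n (f y) (∑ ys f)
∑-∈ {xs = y ∷ ys} f (there x∈ys) = ≤-trans (∑-∈ f x∈ys) (m≤n+m (∑ ys f) (f y))

length-filterᵇ : (p : A → Bool) (xs : List A) → length (filterᵇ p xs) ≡ count p xs
length-filterᵇ p []       = refl
length-filterᵇ p (x ∷ xs) with p x
... | true  = cong suc (length-filterᵇ p xs)
... | false = length-filterᵇ p xs

count-filterᵇ : (p q : A → Bool) (xs : List A) → count q (filterᵇ p xs) ≡ count (λ x → p x ∧ q x) xs
count-filterᵇ p q []       = refl
count-filterᵇ p q (x ∷ xs) with p x
... | true  = cong (𝟙 (q x) +_) (count-filterᵇ p q xs)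
... | false = count-filterᵇ p q xs

count-split : (p q : A → Bool) (xs : List A) →
              count p xs ≡ count (λ x → p x ∧ q x) xs + count (λ x → p x ∧ not (q x)) xs
count-split p q xs = trans (∑-cong xs split) (∑-+ xs _ _)
  where
  split : ∀ x → 𝟙 (p x) ≡ 𝟙 (p x ∧ q x) + 𝟙 (p x ∧ not (q x))
  split x with p x | q x
  ... | true  | true  = refl
  ... | true  | false = refl
  ... | false | _     = refl

module Enumeration {T : Set} (_≟ₜ_ : DecidableEquality T) where

  ExactlyOnce : List T → Set
  ExactlyOnce xs = ∀ z → count (λ x → does (x ≟ₜ z)) xs ≡ 1

  ∑-pick : (xs : List T) → ExactlyOnce xs → ∀ z (f : T → ℕ) → ∑ xs (λ x → 𝟙 (does (x ≟ₜ z)) * f x) ≡ f z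
  ∑-pick xs once z f = begin
    ∑ xs (λ x → 𝟙 (does (x ≟ₜ z)) * f x) ≡⟨ ∑-cong xs at-z ⟩
    ∑ xs (λ x → 𝟙 (does (x ≟ₜ z)) * f z) ≡⟨ ∑-*ʳ xs (f z) _ ⟩
    count (λ x → does (x ≟ₜ z)) xs * f z ≡⟨ cong (_* f z) (once z) ⟩
    1 * f z                              ≡⟨ *-identityˡ (f z) ⟩
    f z                                  ∎
    where
    open ≡-Reasoning
    at-z : ∀ x → 𝟙 (does (x ≟ₜ z)) * f x ≡ 𝟙 (does (x ≟ₜ z)) * f z
    at-z x with x ≟ₜ z
    ... | yes refl = refl
    ... | no  _    = refl

  ∑-reindex : (xs : List T) → ExactlyOnce xs → (σ ρ : T → T) →
              (∀ x → σ (ρ x) ≡ x) → (∀ x → ρ (σ x) ≡ x) →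
              (f : T → ℕ) → ∑ xs (λ x → f (σ x)) ≡ ∑ xs f
  ∑-reindex xs once σ ρ σρ ρσ f = begin
    ∑ xs (λ x → f (σ x))
      ≡⟨ ∑-cong xs (λ x → sym (∑-pick xs once (σ x) f)) ⟩
    ∑ xs (λ x → ∑ xs (λ y → 𝟙 (does (y ≟ₜ σ x)) * f y))
      ≡⟨ ∑-swap xs xs _ ⟩
    ∑ xs (λ y → ∑ xs (λ x → 𝟙 (does (y ≟ₜ σ x)) * f y))
      ≡⟨ ∑-cong xs (λ y → ∑-cong xs (λ x → cong (_* f y) (transfer y x))) ⟩
    ∑ xs (λ y → ∑ xs (λ x → 𝟙 (does (x ≟ₜ ρ y)) * f y))
      ≡⟨ ∑-cong xs (λ y → ∑-*ʳ xs (f y) _) ⟩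
    ∑ xs (λ y → count (λ x → does (x ≟ₜ ρ y)) xs * f y)
      ≡⟨ ∑-cong xs (λ y → trans (cong (_* f y) (once (ρ y))) (*-identityˡ (f y))) ⟩
    ∑ xs f
      ∎
    where
    open ≡-Reasoning
    transfer : ∀ y x → 𝟙 (does (y ≟ₜ σ x)) ≡ 𝟙 (does (x ≟ₜ ρ y))
    transfer y x with y ≟ₜ σ x | x ≟ₜ ρ y
    ... | yes _    | yes _   = refl
    ... | no  _    | no  _   = refl
    ... | yes refl | no x≢ρy = ⊥-elim (x≢ρy (sym (ρσ x)))
    ... | no y≢σx  | yes refl = ⊥-elim (y≢σx (sym (σρ y)))

  count-via-bijections :
    (xs : List T) → ExactlyOnce xs → (S : List I) (σ ρ : I → T → T) →
    (∀ s x → σ s (ρ s x) ≡ x) → (∀ s x → ρ s (σ s x) ≡ x) →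
    (good bad : T → Bool) →
    (∀ v → good v ≡ true → ∃ λ s → s ∈ S × bad (σ s v) ≡ true) →
    count good xs ≤ length S * count bad xs
  count-via-bijections xs once S σ ρ σρ ρσ good bad sent = begin
    count good xs                                  ≤⟨ ∑-mono xs witness ⟩
    ∑ xs (λ v → ∑ S (λ s → 𝟙 (bad (σ s v))))      ≡⟨ ∑-swap xs S _ ⟩
    ∑ S (λ s → ∑ xs (λ v → 𝟙 (bad (σ s v))))      ≡⟨ ∑-cong S (λ s → ∑-reindex xs once (σ s) (ρ s) (σρ s) (ρσ s) _) ⟩
    ∑ S (λ s → count bad xs)                       ≡⟨ ∑-const S (count bad xs) ⟩
    length S * count bad xs                        ∎
    where
    open ≤-Reasoning
    witness : ∀ v → 𝟙 (good v) ≤ ∑ S (λ s → 𝟙 (bad (σ s v)))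
    witness v with good v in good-v
    ... | false = z≤n
    ... | true with sent v good-v
    ...   | s , s∈S , bad-σv = subst (_≤ ∑ S (λ s → 𝟙 (bad (σ s v)))) (cong 𝟙 bad-σv)
                                     (∑-∈ (λ s → 𝟙 (bad (σ s v))) s∈S)

module FinEnum {n : ℕ} = Enumeration {Fin n} _≟_
module VecEnum {m l : ℕ} = Enumeration {Vec (Fin m) l} (≡-decᵥ _≟_)

ExactlyOnce-allFin : ∀ n → FinEnum.ExactlyOnce (allFin n)
ExactlyOnce-allFin (suc n) fzero =
  cong suc (trans (∑-tabulate n fsuc _) (∑-zero (allFin n)))
ExactlyOnce-allFin (suc n) (fsuc j) =
  trans (∑-tabulate n fsuc _) (trans (∑-cong (allFin n) suc-≟) (ExactlyOnce-allFin n j))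
  where
  suc-≟ : ∀ i → 𝟙 (does (fsuc i ≟ fsuc j)) ≡ 𝟙 (does (i ≟ j))
  suc-≟ i with i ≟ j
  ... | yes _ = refl
  ... | no  _ = refl

ExactlyOnce-allVecs : ∀ m l → VecEnum.ExactlyOnce (allVecs m l)
ExactlyOnce-allVecs m zero    []ᵥ = refl
ExactlyOnce-allVecs m (suc l) (j ∷ᵥ v) = begin
  count (λ u → does (≡-decᵥ _≟_ u (j ∷ᵥ v))) (allVecs m (suc l))
    ≡⟨ ∑-concatMap (λ i → map (i ∷ᵥ_) (allVecs m l)) (allFin m) _ ⟩
  ∑ (allFin m) (λ i → ∑ (map (i ∷ᵥ_) (allVecs m l)) (λ u → 𝟙 (does (≡-decᵥ _≟_ u (j ∷ᵥ v)))))
    ≡⟨ ∑-cong (allFin m) (λ i → ∑-map (i ∷ᵥ_) (allVecs m l) _) ⟩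
  ∑ (allFin m) (λ i → ∑ (allVecs m l) (λ w → 𝟙 (does (≡-decᵥ _≟_ (i ∷ᵥ w) (j ∷ᵥ v)))))
    ≡⟨ ∑-cong (allFin m) (λ i → trans (∑-cong (allVecs m l) (cons-≟ i)) (∑-*ˡ (allVecs m l) (𝟙 (does (i ≟ j))) _)) ⟩
  ∑ (allFin m) (λ i → 𝟙 (does (i ≟ j)) * count (λ w → does (≡-decᵥ _≟_ w v)) (allVecs m l))
    ≡⟨ ∑-cong (allFin m) (λ i → trans (cong (𝟙 (does (i ≟ j)) *_) (ExactlyOnce-allVecs m l v)) (*-identityʳ _)) ⟩
  count (λ i → does (i ≟ j)) (allFin m)
    ≡⟨ ExactlyOnce-allFin m j ⟩
  1 ∎
  where
  open ≡-Reasoning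
  cons-≟ : ∀ i w → 𝟙 (does (≡-decᵥ _≟_ (i ∷ᵥ w) (j ∷ᵥ v))) ≡ 𝟙 (does (i ≟ j)) * 𝟙 (does (≡-decᵥ _≟_ w v))
  cons-≟ i w with i ≟ j | ≡-decᵥ _≟_ w v
  ... | yes _ | yes _ = refl
  ... | yes _ | no  _ = refl
  ... | no  _ | _     = refl

allᵇ-sound : (p : A → Bool) (xs : List A) → allᵇ p xs ≡ true → ∀ {x} → x ∈ xs → p x ≡ true
allᵇ-sound p (y ∷ ys) all-p (here refl) with p y
... | true  = refl
... | false = all-p
allᵇ-sound p (y ∷ ys) all-p (there x∈ys) with p y
... | true  = allᵇ-sound p ys all-p x∈ys
... | false with () ← all-p

allᵇ-complete : (p : A → Bool) (xs : List A) → (∀ x → p x ≡ true) → allᵇ p xs ≡ true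
allᵇ-complete p []       p-true = refl
allᵇ-complete p (y ∷ ys) p-true rewrite p-true y = allᵇ-complete p ys p-true

isPerm-sound : ∀ {k} (v : Vec (Fin k) k) → isPerm v ≡ true → Injective _≡_ _≡_ (lookup v)
isPerm-sound {k} v perm {i} {j} vi≡vj =
  decide (allᵇ-sound _ (allFin k) (allᵇ-sound _ (allFin k) perm (∈-allFin i)) (∈-allFin j))
  where
  decide : (does (i ≟ j) ∨ not (does (lookup v i ≟ lookup v j))) ≡ true → i ≡ j
  decide test with i ≟ j | lookup v i ≟ lookup v j
  ... | yes i≡j | _       = i≡j
  ... | no  _   | no vi≢vj = ⊥-elim (vi≢vj vi≡vj)

isPerm-complete : ∀ {k} (v : Vec (Fin k) k) → Injective _≡_ _≡_ (lookup v) → isPerm v ≡ true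
isPerm-complete {k} v inj =
  allᵇ-complete _ (allFin k) (λ i → allᵇ-complete _ (allFin k) (test i))
  where
  test : ∀ i j → (does (i ≟ j) ∨ not (does (lookup v i ≟ lookup v j))) ≡ true
  test i j with i ≟ j | lookup v i ≟ lookup v j
  ... | yes _   | _       = refl
  ... | no i≢j  | yes vi≡vj = ⊥-elim (i≢j (inj vi≡vj))
  ... | no  _   | no  _   = refl

transpose-at-i : ∀ {k} (i j : Fin k) → transpose i j i ≡ j
transpose-at-i i j rewrite dec-true (i ≟ i) refl = refl

transpose-at-j : ∀ {k} (i j : Fin k) → transpose i j j ≡ i
transpose-at-j i j with j ≟ i
... | yes refl = refl
... | no  _ rewrite dec-true (j ≟ j) refl = refl

transpose-elsewhere : ∀ {k} {i j x : Fin k} → x ≢ i → x ≢ j → transpose i j x ≡ x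
transpose-elsewhere {i = i} {j} {x} x≢i x≢j
  rewrite dec-false (x ≟ i) x≢i | dec-false (x ≟ j) x≢j = refl

exchange : ∀ {k} → Fin k → Fin k → Vec (Fin k) k → Vec (Fin k) k
exchange i j v = tabulateᵥ (λ x → lookup v (transpose i j x))

lookup-exchange : ∀ {k} (i j : Fin k) (v : Vec (Fin k) k) x →
                  lookup (exchange i j v) x ≡ lookup v (transpose i j x)
lookup-exchange i j v x = lookup∘tabulate _ x

exchange-inverse : ∀ {k} (i j : Fin k) (v : Vec (Fin k) k) → exchange i j (exchange j i v) ≡ v
exchange-inverse i j v =
  trans (tabulate-cong (λ x → trans (lookup-exchange j i v (transpose i j x))
                                    (cong (lookup v) (transpose-inverse j i))))
        (tabulate∘lookup v)

exchange-injective : ∀ {k} (i j : Fin k) (v : Vec (Fin k) k) →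
                     Injective _≡_ _≡_ (lookup v) → Injective _≡_ _≡_ (lookup (exchange i j v))
exchange-injective i j v inj {x} {y} same =
  trans (sym (transpose-inverse j i))
        (trans (cong (transpose j i)
                     (inj (trans (sym (lookup-exchange i j v x)) (trans same (lookup-exchange i j v y)))))
               (transpose-inverse j i))

πval-≤ : ∀ {k} (v : Vec (Fin k) k) x → πval v x ≤ k
πval-≤ v x = toℕ<n (lookup v x)

πval-injective : ∀ {k} (v : Vec (Fin k) k) → Injective _≡_ _≡_ (lookup v) → Injective _≡_ _≡_ (πval v)
πval-injective v inj same = inj (toℕ-injective (suc-injective same))

πval-exchange : ∀ {k} (i j : Fin k) (v : Vec (Fin k) k) x →
                πval (exchange i j v) x ≡ πval v (transpose i j x)
πval-exchange i j v x = cong (λ z → suc (toℕ z)) (lookup-exchange i j v x)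

guardedMin : (A → Bool) → (A → ℕ) → ℕ → List A → ℕ
guardedMin p g c = foldr (λ x r → if p x then g x ⊓ r else r) c

guardedMin-≤ : (p : A → Bool) (g : A → ℕ) (c : ℕ) {xs : List A} {x : A} →
               x ∈ xs → p x ≡ true → guardedMin p g c xs ≤ g x
guardedMin-≤ p g c {y ∷ ys} (here refl) p-y rewrite p-y = m⊓n≤m (g y) _
guardedMin-≤ p g c {y ∷ ys} (there x∈ys) p-x with p y
... | true  = ≤-trans (m⊓n≤n (g y) _) (guardedMin-≤ p g c x∈ys p-x)
... | false = guardedMin-≤ p g c x∈ys p-x

guardedMin-attained : (p : A → Bool) (g : A → ℕ) (c : ℕ) (xs : List A) →
                      guardedMin p g c xs ≡ c ⊎ ∃ λ x → p x ≡ true × guardedMin p g c xs ≡ g x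
guardedMin-attained p g c [] = inj₁ refl
guardedMin-attained p g c (y ∷ ys) with p y in p-y
... | false = guardedMin-attained p g c ys
... | true with ≤-total (g y) (guardedMin p g c ys) | guardedMin-attained p g c ys
...   | inj₁ gy≤ | _               = inj₂ (y , p-y , m≤n⇒m⊓n≡m gy≤)
...   | inj₂ ≤gy | inj₁ rest≡c     = inj₁ (trans (m≥n⇒m⊓n≡n ≤gy) rest≡c)
...   | inj₂ ≤gy | inj₂ (x , p-x , rest≡gx) = inj₂ (x , p-x , trans (m≥n⇒m⊓n≡n ≤gy) rest≡gx)

guardedMin-> : (p : A → Bool) (g : A → ℕ) {c b : ℕ} (xs : List A) →
               b < c → (∀ x → p x ≡ true → b < g x) → b < guardedMin p g c xs
guardedMin-> p g []       b<c below = b<c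
guardedMin-> p g (y ∷ ys) b<c below with p y in p-y
... | true  = ⊓-glb (below y p-y) (guardedMin-> p g ys b<c below)
... | false = guardedMin-> p g ys b<c below

-- Edge criterion for U(π, X, Y, G): x ∈ X and y ∈ Y are adjacent only if
-- min_{N(y)} π ≤ π(x), since f(x) = π(x) ≤ |X| while f(y) = n + min_{N(y)} π.
adjU-criterion : ∀ {k m} (E : BipGraph k m) (v : Vec (Fin k) k) x y →
                 adjU E v (inj₁ x) (inj₂ y) ≡ true → minNbr E v y ≤ πval v x
adjU-criterion {k} {m} E v x y adjacent = +-cancelˡ-≤ n μ p n+μ≤n+p
  where
  open ≤-Reasoning
  n = k + m
  p = πval v x
  μ = minNbr E v y
  p≤n+μ : p ≤ n + μ
  p≤n+μ = ≤-trans (πval-≤ v x) (≤-trans (m≤m+n k m) (m≤m+n n μ))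
  gap : n + μ ∸ p ≤ n
  gap = subst (_≤ n) (m≤n⇒∣m-n∣≡n∸m p≤n+μ) (≤ᵇ⇒≤ _ _ (subst T (sym adjacent) tt))
  n+μ≤n+p : n + μ ≤ n + p
  n+μ≤n+p = begin
    n + μ             ≤⟨ m≤n+m∸n (n + μ) p ⟩
    p + (n + μ ∸ p)   ≤⟨ +-monoʳ-≤ p gap ⟩
    p + n             ≡⟨ +-comm p n ⟩
    n + p             ∎

adjU-absent : ∀ {k m} (E : BipGraph k m) (v : Vec (Fin k) k) x y →
              πval v x < minNbr E v y → adjU E v (inj₁ x) (inj₂ y) ≡ false
adjU-absent E v x y π<μ with adjU E v (inj₁ x) (inj₂ y) in adjacent
... | false = refl
... | true  = ⊥-elim (<⇒≱ π<μ (adjU-criterion E v x y adjacent))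

adjU-flip : ∀ {k m} (E : BipGraph k m) (v : Vec (Fin k) k) x y →
            adjU E v (inj₂ y) (inj₁ x) ≡ adjU E v (inj₁ x) (inj₂ y)
adjU-flip {k} {m} E v x y =
  cong (λ d → does (d ≤? (k + m))) (∣-∣-comm (fU E v (inj₂ y)) (fU E v (inj₁ x)))

ratio-bound : ∀ {fav unf D} → fav ≤ D * unf → fav * (D + 1) ≤ D * (fav + unf)
ratio-bound {fav} {unf} {D} fav≤ = begin
  fav * (D + 1)      ≡⟨ trans (*-distribˡ-+ fav D 1) (cong₂ _+_ (*-comm fav D) (*-identityʳ fav)) ⟩
  D * fav + fav      ≤⟨ +-monoʳ-≤ (D * fav) fav≤ ⟩
  D * fav + D * unf  ≡⟨ sym (*-distribˡ-+ D fav unf) ⟩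
  D * (fav + unf)    ∎
  where open ≤-Reasoning

module NonEdge {k m : ℕ} (E : BipGraph k m) (x₀ : Fin k) (y : Fin m)
               (x₀y∉E : E x₀ y ≡ false) (y-has-nbr : ∃ λ x → E x y ≡ true) where

  nbr : Fin k → Bool
  nbr x = E x y

  μ : Vec (Fin k) k → ℕ
  μ v = minNbr E v y

  μ-attained : ∀ v → ∃ λ s → nbr s ≡ true × μ v ≡ πval v s
  μ-attained v with guardedMin-attained nbr (πval v) k (allFin k)
  ... | inj₂ attained = attained
  ... | inj₁ μ≡k =
    let (x , x-nbr) = y-has-nbr in
    x , x-nbr , ≤-antisym (guardedMin-≤ nbr (πval v) k (∈-allFin x) x-nbr)
                          (subst (πval v x ≤_) (sym μ≡k) (πval-≤ v x))

  exchange-below-min : ∀ v → Injective _≡_ _≡_ (lookup v) → μ v ≤ πval v x₀ →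
                       ∃ λ s → nbr s ≡ true × πval (exchange x₀ s v) x₀ < μ (exchange x₀ s v)
  exchange-below-min v inj μ≤πx₀ with μ-attained v
  ... | s , s-nbr , μ≡πs = s , s-nbr ,
        subst (_< μ w) (sym (trans (πval-exchange x₀ s v x₀) (cong (πval v) (transpose-at-i x₀ s))))
              (guardedMin-> nbr (πval w) (allFin k) (<-≤-trans πs<πx₀ (πval-≤ v x₀)) above)
    where
    w = exchange x₀ s v
    s≢x₀ : s ≢ x₀
    s≢x₀ refl with trans (sym s-nbr) x₀y∉E
    ... | ()
    πs<πx₀ : πval v s < πval v x₀
    πs<πx₀ = ≤∧≢⇒< (subst (_≤ πval v x₀) μ≡πs μ≤πx₀) (λ same → s≢x₀ (πval-injective v inj same))
    above : ∀ x → nbr x ≡ true → πval v s < πval w x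
    above x x-nbr with x ≟ x₀ | x ≟ s
    ... | yes refl | _ with trans (sym x-nbr) x₀y∉E
    ...   | ()
    above x x-nbr | no _ | yes refl =
      subst (πval v s <_) (sym (trans (πval-exchange x₀ s v s) (cong (πval v) (transpose-at-j x₀ s)))) πs<πx₀
    above x x-nbr | no x≢x₀ | no x≢s =
      subst (πval v s <_) (sym (trans (πval-exchange x₀ s v x) (cong (πval v) (transpose-elsewhere x≢x₀ x≢s))))
            (≤∧≢⇒< (subst (_≤ πval v x) μ≡πs (guardedMin-≤ nbr (πval v) k (∈-allFin x) x-nbr))
                   (λ same → x≢s (sym (πval-injective v inj same))))

  edge : Vec (Fin k) k → Bool
  edge v = adjU E v (inj₁ x₀) (inj₂ y)

  favourable unfavourable : Vec (Fin k) k → Bool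
  favourable   v = isPerm v ∧ edge v
  unfavourable v = isPerm v ∧ not (edge v)

  favourable-exchange : ∀ v → favourable v ≡ true →
                        ∃ λ s → s ∈ filterᵇ nbr (allFin k) × unfavourable (exchange x₀ s v) ≡ true
  favourable-exchange v fav with isPerm v in perm | edge v in is-edge
  ... | true | true with exchange-below-min v (isPerm-sound v perm) (adjU-criterion E v x₀ y is-edge)
  ...   | s , s-nbr , below =
    s , ∈-filter⁺ (λ x → T? (nbr x)) (∈-allFin s) (subst T (sym s-nbr) tt) , unfav
    where
    w = exchange x₀ s v
    unfav : isPerm w ∧ not (edge w) ≡ true
    unfav rewrite isPerm-complete w (exchange-injective x₀ s v (isPerm-sound v perm))
                | adjU-absent E w x₀ y below = refl

  favourable-bound : count favourable (allVecs k k) ≤ degB E y * count unfavourable (allVecs k k)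
  favourable-bound =
    VecEnum.count-via-bijections (allVecs k k) (ExactlyOnce-allVecs k k) (filterᵇ nbr (allFin k))
      (λ s → exchange x₀ s) (λ s → exchange s x₀)
      (λ s → exchange-inverse x₀ s) (λ s → exchange-inverse s x₀)
      favourable unfavourable favourable-exchange

  -- the edge probability #fav/#all of x₀ y is at most D/(D+1) whenever d(y) ≤ D;
  -- edge′ is any predicate agreeing with edge (e.g. edge with the pair listed as y x₀)
  edge-probability : (edge′ : Vec (Fin k) k → Bool) → (∀ v → edge′ v ≡ edge v) →
                     (D : ℕ) → degB E y ≤ D →
                     length (filterᵇ edge′ (allPerms k)) * (D + 1) ≤ D * length (allPerms k)
  edge-probability edge′ edge′≡edge D deg≤D =
    subst₂ (λ f t → f * (D + 1) ≤ D * t) (sym #fav) (sym #all)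
           (ratio-bound (≤-trans favourable-bound (*-monoˡ-≤ _ deg≤D)))
    where
    fav = count favourable (allVecs k k)
    unf = count unfavourable (allVecs k k)
    #fav : length (filterᵇ edge′ (allPerms k)) ≡ fav
    #fav = trans (length-filterᵇ edge′ (allPerms k))
           (trans (count-filterᵇ isPerm edge′ (allVecs k k))
                  (∑-cong (allVecs k k) (λ v → cong (λ e → 𝟙 (isPerm v ∧ e)) (edge′≡edge v))))
    #all : length (allPerms k) ≡ fav + unf
    #all = trans (length-filterᵇ isPerm (allVecs k k)) (count-split isPerm edge (allVecs k k))

maxFin-≥ : ∀ {n} (f : Fin n → ℕ) i → f i ≤ maxFin f
maxFin-≥ {n} f i = below-fold (allFin n) (∈-allFin i)
  where
  below-fold : (xs : List (Fin n)) → i ∈ xs → f i ≤ foldr (λ j r → f j ⊔ r) 0 xs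
  below-fold (j ∷ js) (here refl) = m≤m⊔n (f j) _
  below-fold (j ∷ js) (there i∈js) = ≤-trans (below-fold js i∈js) (m≤n⊔m (f j) _)

lemma3p1 : ∀ {n₁ n₂} (E : BipGraph n₁ n₂)
    → (∀ a → ∃ λ b → E a b ≡ true)
    → (∀ b → ∃ λ a → E a b ≡ true)
    → (a : Fin n₁) (b : Fin n₂) → E a b ≡ false
    → randUnitFavourable E a b * (Δ′ E + 1) ≤ Δ′ E * randUnitTotal E
lemma3p1 E a-has-nbr b-has-nbr a b ab∉E with ΔB E ≤ᵇ ΔA E in side
... | true =
  -- the ordering is on A, and Δ′ = Δ_B bounds d(b)
  NonEdge.edge-probability E a b ab∉E (b-has-nbr b) _ (λ v → refl) (Δ′ E)
    (subst (degB E b ≤_) (sym (m≥n⇒m⊓n≡n ΔB≤ΔA)) (maxFin-≥ (degB E) b))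
  where
  ΔB≤ΔA : ΔB E ≤ ΔA E
  ΔB≤ΔA = ≤ᵇ⇒≤ (ΔB E) (ΔA E) (subst T (sym side) tt)
... | false =
  -- the ordering is on B (the parts swap roles), and Δ′ = Δ_A bounds d(a)
  NonEdge.edge-probability (transposeG E) b a ab∉E (a-has-nbr a) _ (λ v → adjU-flip (transposeG E) v b a) (Δ′ E)
    (subst (degA E a ≤_) (sym (m≤n⇒m⊓n≡m ΔA≤ΔB)) (maxFin-≥ (degA E) a))
  where
  ΔA≤ΔB : ΔA E ≤ ΔB E
  ΔA≤ΔB = ≰⇒≥ (λ ΔB≤ΔA → subst T side (≤⇒≤ᵇ ΔB≤ΔA))
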